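{- Let $G$ be a graph on $n$ vertices and let $G^b=(V,E^b)$ be $G$ with each edge duplicated $b$ times, for a positive integer $b$. Let $\rho_b=\max_{\emptyset\ne S\subseteq V}|E^b[S]|/|S|$ be the maximum subgraph density of $G^b$. Let $\eta>0$ and $c\ge0$, and let $\overrightarrow{G}^b$ be any orientation of $G^b$ such that every directed edge $\overrightarrow{uv}$ satisfies $d^+(u)\le(1+\eta b^{ -1})\,d^+(v)+c$. Then for any $\gamma>0$ there exists a value $k_{\max}\le\log_{1+\gamma}n$ for which \[(1+\eta b^{ -1})^{ -k_{\max}}\,\Delta(\overrightarrow{G}^b)\le(1+\gamma)\rho_b+c(\eta^{ -1}b+1).\]
   Context: $E^b[S]$ is the multiset of edges of $G^b$ with both endpoints in $S$. $d^+(u)$ is the number of edge copies directed out of $u$ in $\overrightarrow{G}^b$, and $\Delta(\overrightarrow{G}^b)=\max_v d^+(v)$.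
   Formalization: The parameters η, c and γ range over the rationals. -}

module Defs where

open import Data.Bool using (Bool; true; false; _∧_; if_then_else_)
open import Data.Nat as ℕ using (ℕ; zero; suc)
open import Data.Fin using (Fin; toℕ)
open import Data.Vec using (Vec; []; _∷_; lookup)
open import Data.List using (List; []; _∷_; map; foldr; allFin; _++_)
open import Data.Nat.ListAction using (sum)
open import Data.Fin.Subset using (Subset; ∣_∣)
open import Data.Integer using (+_)
open import Data.Rational using (ℚ; 0ℚ; 1ℚ; _/_; _*_; _⊔_; 1/_; _≟_; ≢-nonZero)
open import Relation.Nullary using (yes; no)
open import Relation.Binary.PropositionalEquality using (_≡_)

record SimpleGraph (n : ℕ) : Set where
  field
    adj    : Fin n → Fin n → Bool
    sym    : ∀ u v → adj u v ≡ adj v u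
    irrefl : ∀ u → adj u u ≡ false
open SimpleGraph public

-- An orientation of G^b (each edge of G duplicated b times): out u v is the
-- number of the b copies of the edge uv that are directed from u to v.
record Orientation {n : ℕ} (G : SimpleGraph n) (b : ℕ) : Set where
  field
    out      : Fin n → Fin n → ℕ
    split    : ∀ u v → adj G u v ≡ true → out u v ℕ.+ out v u ≡ b
    nonEdge  : ∀ u v → adj G u v ≡ false → out u v ≡ 0
open Orientation public

Σv : (n : ℕ) → (Fin n → ℕ) → ℕ
Σv n f = sum (map f (allFin n))

d⁺ : {n : ℕ} {G : SimpleGraph n} {b : ℕ} → Orientation G b → Fin n → ℕ
d⁺ {n} O u = Σv n (λ v → out O u v)

Δ : {n : ℕ} {G : SimpleGraph n} {b : ℕ} → Orientation G b → ℕ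
Δ {n} O = foldr ℕ._⊔_ 0 (map (d⁺ O) (allFin n))

toℚ : ℕ → ℚ
toℚ k = (+ k) / 1

bit : Bool → ℕ
bit true  = 1
bit false = 0

edgesIn : {n : ℕ} → SimpleGraph n → Subset n → ℕ
edgesIn {n} G S =
  Σv n (λ u → Σv n (λ v →
    bit (lookup S u ∧ lookup S v ∧ (toℕ u ℕ.<ᵇ toℕ v) ∧ adj G u v)))

edgesInᵇ : {n : ℕ} → SimpleGraph n → ℕ → Subset n → ℕ
edgesInᵇ G b S = b ℕ.* edgesIn G S

-- e / s as a rational (only used with s ≥ 1)
frac : ℕ → ℕ → ℚ
frac e zero    = 0ℚ
frac e (suc s) = (+ e) / suc s

allSubsets : (n : ℕ) → List (Subset n)
allSubsets zero    = [] ∷ []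
allSubsets (suc n) = map (true ∷_) (allSubsets n) ++ map (false ∷_) (allSubsets n)

-- ρ_b = max over nonempty S of |E^b[S]| / |S|.
-- (The empty set contributes 0 via frac, which does not affect the maximum
--  since all densities are ≥ 0 and the max is taken starting from 0.)
ρ : {n : ℕ} → SimpleGraph n → ℕ → ℚ
ρ {n} G b = foldr _⊔_ 0ℚ (map (λ S → frac (edgesInᵇ G b S) ∣ S ∣) (allSubsets n))

-- total inverse on ℚ (only applied to nonzero arguments)
inv : ℚ → ℚ
inv p with p ≟ 0ℚ
... | yes _  = 0ℚ
... | no p≢0 = 1/_ p {{≢-nonZero p≢0}}

pow : ℚ → ℕ → ℚ
pow x zero    = 1ℚ
pow x (suc k) = x * pow x k

{-# OPTIONS --safe #-}
module Submission where

-- Let u be a vertex of maximum out-degree and let B_i be the set of vertices reachable from u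
-- along at most i arcs. With α = 1 + η/b and K = cb/η the hypothesis becomes
-- d⁺(x) + K ≤ α (d⁺(y) + K) along every arc x → y, so every vertex of B_i satisfies
-- d⁺ + K ≥ α⁻ⁱ (Δ + K). As 1 ≤ |B_i| ≤ n, the sizes cannot keep growing by the factor 1 + γ:
-- at the first k with |B_{k+1}| < (1 + γ) |B_k| we have (1 + γ)ᵏ ≤ |B_k| ≤ n. Every arc leaving
-- B_k ends in B_{k+1}, so summing out-degrees over B_k gives
-- |B_k| (α⁻ᵏ (Δ + K) - K) ≤ |E^b[B_{k+1}]| ≤ ρ_b |B_{k+1}| < (1 + γ) ρ_b |B_k|.

open import Defs hiding (sym)
open import Data.Nat using (ℕ; _≤_)
open import Data.Rational using (ℚ; 0ℚ; 1ℚ; _+_; _*_) renaming (_≤_ to _≤ℚ_; _<_ to _<ℚ_)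
open import Data.Product using (_×_; ∃-syntax)

open import Algebra.Bundles using (CommutativeRing)
import Algebra.Properties.Semiring.Sum as SemiringSum
open import Data.Bool using (Bool; true; false; _∧_; _∨_; T; T?)
open import Data.Bool.Properties using (T-∧; T-∨)
open import Data.Empty using (⊥-elim)
open import Data.Fin using (Fin)
import Data.Fin as Fin
open import Data.Fin.Properties using (any?; toℕ-injective)
open import Data.Fin.Subset using (Subset; ∣_∣)
import Data.Integer as ℤ
import Data.Integer.Properties as ℤP
open import Data.Integer.Tactic.RingSolver using (solve-∀)
import Data.List as List
import Data.List.Properties as List
open import Data.List.Membership.Propositional using (_∈_; lose)
open import Data.List.Membership.Propositional.Properties using (∈-map⁺; ∈-map⁻; ∈-++⁺ˡ; ∈-++⁺ʳ; foldr-selective)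
open import Data.List.Relation.Unary.Any using (Any; here)
import Data.Nat as ℕ
open import Data.Nat.ListAction using (sum)
import Data.Nat.Properties as ℕP
open import Data.Product using (_,_; proj₁; proj₂)
import Data.Product as Product
open import Data.Rational using (toℚᵘ; _⊔_; _≟_; positive; nonNegative; ≢-nonZero)
open import Data.Rational.Properties
open import Data.Rational.Solver using (module +-*-Solver)
import Data.Rational.Unnormalised as ℚᵘ
import Data.Rational.Unnormalised.Properties as ℚᵘP
open import Data.Sum using (_⊎_; inj₁; inj₂; [_,_])
import Data.Sum as Sum
import Data.Vec as Vec
import Data.Vec.Properties as VecP
open import Function using (_∘_; id; Equivalence)
open import Relation.Binary.PropositionalEquality hiding ([_])
open import Relation.Nullary using (yes; no)
open import Relation.Nullary.Decidable using (Dec; isYes; toWitness; fromWitness; _×-dec_)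
open import Relation.Nullary.Reflects using (ofʸ; ofⁿ)

toℚᵘ-toℚ : ∀ k → toℚᵘ (toℚ k) ℚᵘ.≃ ℚᵘ.mkℚᵘ (ℤ.+ k) 0
toℚᵘ-toℚ k = toℚᵘ-fromℚᵘ (ℚᵘ.mkℚᵘ (ℤ.+ k) 0)

toℚ-+ : ∀ m n → toℚ (m ℕ.+ n) ≡ toℚ m + toℚ n
toℚ-+ m n = toℚᵘ-injective (begin
  toℚᵘ (toℚ (m ℕ.+ n))                        ≈⟨ toℚᵘ-toℚ (m ℕ.+ n) ⟩
  ℚᵘ.mkℚᵘ (ℤ.+ (m ℕ.+ n)) 0                  ≡⟨ cong (λ z → ℚᵘ.mkℚᵘ z 0) (ℤP.pos-+ m n) ⟩
  ℚᵘ.mkℚᵘ (ℤ.+ m ℤ.+ ℤ.+ n) 0                ≈⟨ ℚᵘ.*≡* (lemma (ℤ.+ m) (ℤ.+ n)) ⟩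
  ℚᵘ.mkℚᵘ (ℤ.+ m) 0 ℚᵘ.+ ℚᵘ.mkℚᵘ (ℤ.+ n) 0  ≈⟨ ℚᵘP.+-cong (toℚᵘ-toℚ m) (toℚᵘ-toℚ n) ⟨
  toℚᵘ (toℚ m) ℚᵘ.+ toℚᵘ (toℚ n)              ≈⟨ toℚᵘ-homo-+ (toℚ m) (toℚ n) ⟨
  toℚᵘ (toℚ m + toℚ n)                        ∎)
  where
  open ℚᵘP.≃-Reasoning
  lemma : ∀ a b → (a ℤ.+ b) ℤ.* (ℤ.+ 1 ℤ.* ℤ.+ 1) ≡ (a ℤ.* ℤ.+ 1 ℤ.+ b ℤ.* ℤ.+ 1) ℤ.* ℤ.+ 1
  lemma = solve-∀

toℚ-mono : ∀ {m n} → m ≤ n → toℚ m ≤ℚ toℚ n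
toℚ-mono {m} {n} m≤n = toℚᵘ-cancel-≤
  (ℚᵘP.≤-respˡ-≃ (ℚᵘP.≃-sym (toℚᵘ-toℚ m)) (ℚᵘP.≤-respʳ-≃ (ℚᵘP.≃-sym (toℚᵘ-toℚ n))
    (ℚᵘ.*≤* (ℤP.*-monoʳ-≤-nonNeg (ℤ.+ 1) (ℤ.+≤+ m≤n)))))

toℚ-cancel-< : ∀ {m n} → toℚ m <ℚ toℚ n → m ℕ.< n
toℚ-cancel-< m<n = ℕP.≰⇒> λ n≤m → <-irrefl refl (<-≤-trans m<n (toℚ-mono n≤m))

toℚ-nonNeg : ∀ k → 0ℚ ≤ℚ toℚ k
toℚ-nonNeg k = toℚ-mono {0} {k} ℕ.z≤n

toℚ-pos : ∀ {k} → 1 ≤ k → 0ℚ <ℚ toℚ k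
toℚ-pos {k} 1≤k = <-≤-trans (positive⁻¹ 1ℚ) (toℚ-mono {1} {k} 1≤k)

*-pos : ∀ {p q} → 0ℚ <ℚ p → 0ℚ <ℚ q → 0ℚ <ℚ p * q
*-pos {p} {q} 0<p 0<q = positive⁻¹ (p * q) {{pos*pos⇒pos p {{positive 0<p}} q {{positive 0<q}}}}

*-nonNeg : ∀ {p q} → 0ℚ ≤ℚ p → 0ℚ ≤ℚ q → 0ℚ ≤ℚ p * q
*-nonNeg {p} {q} 0≤p 0≤q = nonNegative⁻¹ (p * q) {{nonNeg*nonNeg⇒nonNeg p {{nonNegative 0≤p}} q {{nonNegative 0≤q}}}}

p≤p+q : ∀ {p q} → 0ℚ ≤ℚ q → p ≤ℚ p + q
p≤p+q {p} 0≤q = ≤-trans (≤-reflexive (sym (+-identityʳ p))) (+-monoʳ-≤ p 0≤q)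

pow-nonNeg : ∀ {p} k → 0ℚ ≤ℚ p → 0ℚ ≤ℚ pow p k
pow-nonNeg ℕ.zero    0≤p = nonNegative⁻¹ 1ℚ
pow-nonNeg (ℕ.suc k) 0≤p = *-nonNeg 0≤p (pow-nonNeg k 0≤p)

inv-pos : ∀ {p} → 0ℚ <ℚ p → 0ℚ <ℚ inv p
inv-pos {p} 0<p with p ≟ 0ℚ
... | yes p≡0 = ⊥-elim (<-irrefl (sym p≡0) 0<p)
... | no  p≢0 = positive⁻¹ _ {{1/pos⇒pos p {{positive 0<p}}}}

*-inv : ∀ {p} → 0ℚ <ℚ p → p * inv p ≡ 1ℚ
*-inv {p} 0<p with p ≟ 0ℚ
... | yes p≡0 = ⊥-elim (<-irrefl (sym p≡0) 0<p)
... | no  p≢0 = *-inverseʳ p {{≢-nonZero p≢0}}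

inv≤1 : ∀ {p} → 1ℚ ≤ℚ p → inv p ≤ℚ 1ℚ
inv≤1 {p} 1≤p = begin
  inv p        ≡⟨ *-identityʳ (inv p) ⟨
  inv p * 1ℚ   ≤⟨ *-monoˡ-≤-nonNeg (inv p) {{nonNegative (<⇒≤ (inv-pos 0<p))}} 1≤p ⟩
  inv p * p    ≡⟨ trans (*-comm (inv p) p) (*-inv 0<p) ⟩
  1ℚ           ∎
  where open ≤-Reasoning
        0<p = <-≤-trans (positive⁻¹ 1ℚ) 1≤p

absorb-slack : ∀ {α c K x y} → α * K ≡ K + c → x ≤ℚ α * y + c → x + K ≤ℚ α * (y + K)
absorb-slack {α} {c} {K} {x} {y} α*K≡K+c x≤αy+c = begin
  x + K              ≤⟨ +-monoˡ-≤ K x≤αy+c ⟩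
  α * y + c + K      ≡⟨ solve 4 (λ a y c k → a :* y :+ c :+ k := a :* y :+ (k :+ c)) refl α y c K ⟩
  α * y + (K + c)    ≡⟨ cong (α * y +_) α*K≡K+c ⟨
  α * y + α * K      ≡⟨ *-distribˡ-+ α y K ⟨
  α * (y + K)        ∎
  where open ≤-Reasoning
        open +-*-Solver

p<[1+q]*p : ∀ {p q} → 0ℚ <ℚ q → 0ℚ <ℚ p → p <ℚ (1ℚ + q) * p
p<[1+q]*p {p} {q} 0<q 0<p = begin-strict
  p            ≡⟨ +-identityʳ p ⟨
  p + 0ℚ       <⟨ +-monoʳ-< p (*-pos 0<q 0<p) ⟩
  p + q * p    ≡⟨ solve 2 (λ p q → p :+ q :* p := (con 1ℚ :+ q) :* p) refl p q ⟩
  (1ℚ + q) * p ∎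
  where open ≤-Reasoning
        open +-*-Solver

growth-stalls : ∀ {N γ} → 0ℚ <ℚ γ → (a : ℕ → ℕ) → (∀ j → 1 ≤ a j) → (∀ j → a j ≤ N) →
  ∃[ k ] (pow (1ℚ + γ) k ≤ℚ toℚ (a k) × toℚ (a (ℕ.suc k)) <ℚ (1ℚ + γ) * toℚ (a k))
growth-stalls {N} {γ} 0<γ a 1≤a a≤N =
  [ (λ (N<a , _) → ⊥-elim (ℕP.<-irrefl refl (ℕP.<-≤-trans N<a (a≤N N)))) , id ] (search N)
  where
  Stall : Set
  Stall = ∃[ k ] (pow (1ℚ + γ) k ≤ℚ toℚ (a k) × toℚ (a (ℕ.suc k)) <ℚ (1ℚ + γ) * toℚ (a k))

  0≤1+γ : 0ℚ ≤ℚ 1ℚ + γ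
  0≤1+γ = +-mono-≤ (nonNegative⁻¹ 1ℚ) (<⇒≤ 0<γ)

  search : ∀ m → (m ℕ.< a m × pow (1ℚ + γ) m ≤ℚ toℚ (a m)) ⊎ Stall
  search ℕ.zero = inj₁ (1≤a 0 , toℚ-mono {1} (1≤a 0))
  search (ℕ.suc m) with search m
  ... | inj₂ stall = inj₂ stall
  ... | inj₁ (m<a , pow≤a) with (1ℚ + γ) * toℚ (a m) ≤? toℚ (a (ℕ.suc m))
  ...   | no  ¬grows = inj₂ (m , pow≤a , ≰⇒> ¬grows)
  ...   | yes grows  = inj₁
    ( ℕP.≤-trans (ℕ.s≤s m<a) (toℚ-cancel-< (<-≤-trans (p<[1+q]*p 0<γ (toℚ-pos (1≤a m))) grows))
    , ≤-trans (*-monoˡ-≤-nonNeg (1ℚ + γ) {{nonNegative 0≤1+γ}} pow≤a) grows )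

module ℕΣ = SemiringSum ℕP.+-*-semiring
module ℚΣ = SemiringSum (CommutativeRing.semiring +-*-commutativeRing)

∑ : ∀ {n} → (Fin n → ℕ) → ℕ
∑ = ℕΣ.sum

∑ℚ : ∀ {n} → (Fin n → ℚ) → ℚ
∑ℚ = ℚΣ.sum

sum-tabulate : ∀ {n} (f : Fin n → ℕ) → sum (List.tabulate f) ≡ ∑ f
sum-tabulate {ℕ.zero}  f = refl
sum-tabulate {ℕ.suc n} f = cong (f Fin.zero ℕ.+_) (sum-tabulate (f ∘ Fin.suc))

Σv≡∑ : ∀ n (f : Fin n → ℕ) → Σv n f ≡ ∑ f
Σv≡∑ n f = trans (cong sum (List.map-tabulate id f)) (sum-tabulate f)

∑-mono-≤ : ∀ {n} {f g : Fin n → ℕ} → (∀ i → f i ≤ g i) → ∑ f ≤ ∑ g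
∑-mono-≤ {ℕ.zero}  f≤g = ℕ.z≤n
∑-mono-≤ {ℕ.suc n} f≤g = ℕP.+-mono-≤ (f≤g Fin.zero) (∑-mono-≤ (f≤g ∘ Fin.suc))

∑ℚ-mono-≤ : ∀ {n} {f g : Fin n → ℚ} → (∀ i → f i ≤ℚ g i) → ∑ℚ f ≤ℚ ∑ℚ g
∑ℚ-mono-≤ {ℕ.zero}  f≤g = ≤-refl
∑ℚ-mono-≤ {ℕ.suc n} f≤g = +-mono-≤ (f≤g Fin.zero) (∑ℚ-mono-≤ (f≤g ∘ Fin.suc))

∑-≤-* : ∀ {n c} {f : Fin n → ℕ} → (∀ i → f i ≤ c) → ∑ f ≤ n ℕ.* c
∑-≤-* {ℕ.zero}  f≤c = ℕ.z≤n
∑-≤-* {ℕ.suc n} f≤c = ℕP.+-mono-≤ (f≤c Fin.zero) (∑-≤-* (f≤c ∘ Fin.suc))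

f≤∑ : ∀ {n} (f : Fin n → ℕ) i → f i ≤ ∑ f
f≤∑ f Fin.zero    = ℕP.m≤m+n _ _
f≤∑ f (Fin.suc i) = ℕP.≤-trans (f≤∑ (f ∘ Fin.suc) i) (ℕP.m≤n+m _ _)

toℚ-∑ : ∀ {n} (f : Fin n → ℕ) → toℚ (∑ f) ≡ ∑ℚ (toℚ ∘ f)
toℚ-∑ {ℕ.zero}  f = refl
toℚ-∑ {ℕ.suc n} f = trans (toℚ-+ (f Fin.zero) (∑ (f ∘ Fin.suc))) (cong (toℚ (f Fin.zero) +_) (toℚ-∑ (f ∘ Fin.suc)))

bit≤1 : ∀ a → bit a ≤ 1
bit≤1 false = ℕ.z≤n
bit≤1 true  = ℕP.≤-refl

bit-T : ∀ {a} → T a → 1 ≤ bit a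
bit-T {true} _ = ℕP.≤-refl

bit-*-mono : ∀ a c o → (T a → 1 ≤ o → T c) → bit a ℕ.* o ≤ bit c ℕ.* o
bit-*-mono false c     o         _   = ℕ.z≤n
bit-*-mono true  c     ℕ.zero    _   = ℕ.z≤n
bit-*-mono true  true  (ℕ.suc o) _   = ℕP.≤-refl
bit-*-mono true  false (ℕ.suc o) a⇒c = ⊥-elim (a⇒c _ (ℕ.s≤s ℕ.z≤n))

size : ∀ {n} → (Fin n → Bool) → ℕ
size A = ∑ (bit ∘ A)

∣tabulate∣≡size : ∀ {n} (A : Fin n → Bool) → ∣ Vec.tabulate A ∣ ≡ size A
∣tabulate∣≡size {ℕ.zero}  A = refl
∣tabulate∣≡size {ℕ.suc n} A with A Fin.zero
... | true  = cong ℕ.suc (∣tabulate∣≡size (A ∘ Fin.suc))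
... | false = ∣tabulate∣≡size (A ∘ Fin.suc)

indicator-bound : ∀ a {x K} y → (T a → x ≤ℚ toℚ y + K) → toℚ (bit a) * x ≤ℚ toℚ (bit a ℕ.* y) + toℚ (bit a) * K
indicator-bound false {x} {K} y _ = ≤-reflexive (trans (*-zeroˡ x) (sym (trans (+-identityˡ (0ℚ * K)) (*-zeroˡ K))))
indicator-bound true  {x} {K} y x≤y+K = begin
  1ℚ * x              ≡⟨ *-identityˡ x ⟩
  x                   ≤⟨ x≤y+K _ ⟩
  toℚ y + K           ≡⟨ cong₂ _+_ (cong toℚ (ℕP.+-identityʳ y)) (*-identityˡ K) ⟨
  toℚ (y ℕ.+ 0) + 1ℚ * K ∎
  where open ≤-Reasoning

size*≤∑ : ∀ {n} (A : Fin n → Bool) (f : Fin n → ℕ) {x K} → (∀ v → T (A v) → x ≤ℚ toℚ (f v) + K) →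
  toℚ (size A) * x ≤ℚ toℚ (∑ (λ v → bit (A v) ℕ.* f v)) + toℚ (size A) * K
size*≤∑ A f {x} {K} x≤f+K = begin
  toℚ (size A) * x
    ≡⟨ trans (cong (_* x) (toℚ-∑ (bit ∘ A))) (ℚΣ.*-distribʳ-sum x (toℚ ∘ bit ∘ A)) ⟩
  ∑ℚ (λ v → toℚ (bit (A v)) * x)
    ≤⟨ ∑ℚ-mono-≤ (λ v → indicator-bound (A v) (f v) (x≤f+K v)) ⟩
  ∑ℚ (λ v → toℚ (bit (A v) ℕ.* f v) + toℚ (bit (A v)) * K)
    ≡⟨ ℚΣ.∑-distrib-+ (λ v → toℚ (bit (A v) ℕ.* f v)) (λ v → toℚ (bit (A v)) * K) ⟩
  ∑ℚ (λ v → toℚ (bit (A v) ℕ.* f v)) + ∑ℚ (λ v → toℚ (bit (A v)) * K)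
    ≡⟨ cong₂ _+_ (toℚ-∑ (λ v → bit (A v) ℕ.* f v))
                 (trans (cong (_* K) (toℚ-∑ (bit ∘ A))) (ℚΣ.*-distribʳ-sum K (toℚ ∘ bit ∘ A))) ⟨
  toℚ (∑ (λ v → bit (A v) ℕ.* f v)) + toℚ (size A) * K ∎
  where open ≤-Reasoning

below : ∀ {n} → Fin n → Fin n → ℕ
below i j = bit (Fin.toℕ i ℕ.<ᵇ Fin.toℕ j)

split-off-diagonal : ∀ {n} (g : Fin n → Fin n → ℕ) → (∀ i → g i i ≡ 0) →
  ∀ i j → g i j ≡ below i j ℕ.* g i j ℕ.+ below j i ℕ.* g i j
split-off-diagonal g g-diag i j
  with Fin.toℕ i ℕ.<ᵇ Fin.toℕ j | ℕP.<ᵇ-reflects-< (Fin.toℕ i) (Fin.toℕ j)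
     | Fin.toℕ j ℕ.<ᵇ Fin.toℕ i | ℕP.<ᵇ-reflects-< (Fin.toℕ j) (Fin.toℕ i)
... | true  | ofʸ i<j | true  | ofʸ j<i = ⊥-elim (ℕP.<-asym i<j j<i)
... | true  | _       | false | _       = sym (trans (ℕP.+-identityʳ _) (ℕP.*-identityˡ _))
... | false | _       | true  | _       = sym (ℕP.*-identityˡ _)
... | false | ofⁿ i≮j | false | ofⁿ j≮i
  with refl ← toℕ-injective (ℕP.≤-antisym (ℕP.≮⇒≥ j≮i) (ℕP.≮⇒≥ i≮j)) = g-diag i

∑∑-distrib-+ : ∀ {n} (f g : Fin n → Fin n → ℕ) →
  ∑ (λ i → ∑ (λ j → f i j ℕ.+ g i j)) ≡ ∑ (λ i → ∑ (f i)) ℕ.+ ∑ (λ i → ∑ (g i))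
∑∑-distrib-+ f g = trans (ℕΣ.sum-cong-≗ (λ i → ℕΣ.∑-distrib-+ (f i) (g i)))
                         (ℕΣ.∑-distrib-+ (λ i → ∑ (f i)) (λ i → ∑ (g i)))

∑∑-*-distribˡ : ∀ {n} c (f : Fin n → Fin n → ℕ) →
  c ℕ.* ∑ (λ i → ∑ (f i)) ≡ ∑ (λ i → ∑ (λ j → c ℕ.* f i j))
∑∑-*-distribˡ c f = trans (ℕΣ.*-distribˡ-sum c (λ i → ∑ (f i))) (ℕΣ.sum-cong-≗ λ i → ℕΣ.*-distribˡ-sum c (f i))

∑∑-symmetrize : ∀ {n} (g : Fin n → Fin n → ℕ) → (∀ i → g i i ≡ 0) →
  ∑ (λ i → ∑ (g i)) ≡ ∑ (λ i → ∑ (λ j → below i j ℕ.* (g i j ℕ.+ g j i)))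
∑∑-symmetrize g g-diag = begin
  ∑ (λ i → ∑ (g i))
    ≡⟨ ℕΣ.sum-cong-≗ (λ i → ℕΣ.sum-cong-≗ (split-off-diagonal g g-diag i)) ⟩
  ∑ (λ i → ∑ (λ j → below i j ℕ.* g i j ℕ.+ below j i ℕ.* g i j))
    ≡⟨ ∑∑-distrib-+ (λ i j → below i j ℕ.* g i j) (λ i j → below j i ℕ.* g i j) ⟩
  ∑ (λ i → ∑ (λ j → below i j ℕ.* g i j)) ℕ.+ ∑ (λ i → ∑ (λ j → below j i ℕ.* g i j))
    ≡⟨ cong₂ ℕ._+_ refl (ℕΣ.∑-comm (λ i j → below j i ℕ.* g i j)) ⟩
  ∑ (λ i → ∑ (λ j → below i j ℕ.* g i j)) ℕ.+ ∑ (λ i → ∑ (λ j → below i j ℕ.* g j i))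
    ≡⟨ ∑∑-distrib-+ (λ i j → below i j ℕ.* g i j) (λ i j → below i j ℕ.* g j i) ⟨
  ∑ (λ i → ∑ (λ j → below i j ℕ.* g i j ℕ.+ below i j ℕ.* g j i))
    ≡⟨ ℕΣ.sum-cong-≗ (λ i → ℕΣ.sum-cong-≗ (λ j → ℕP.*-distribˡ-+ (below i j) (g i j) (g j i))) ⟨
  ∑ (λ i → ∑ (λ j → below i j ℕ.* (g i j ℕ.+ g j i))) ∎
  where open ≡-Reasoning

frac-*-denominator : ∀ e s → frac e (ℕ.suc s) * toℚ (ℕ.suc s) ≡ toℚ e
frac-*-denominator e s = toℚᵘ-injective (begin
  toℚᵘ (frac e (ℕ.suc s) * toℚ (ℕ.suc s))
    ≈⟨ toℚᵘ-homo-* (frac e (ℕ.suc s)) (toℚ (ℕ.suc s)) ⟩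
  toℚᵘ (frac e (ℕ.suc s)) ℚᵘ.* toℚᵘ (toℚ (ℕ.suc s))
    ≈⟨ ℚᵘP.*-cong (toℚᵘ-fromℚᵘ (ℚᵘ.mkℚᵘ (ℤ.+ e) s)) (toℚᵘ-toℚ (ℕ.suc s)) ⟩
  ℚᵘ.mkℚᵘ (ℤ.+ e) s ℚᵘ.* ℚᵘ.mkℚᵘ (ℤ.+ ℕ.suc s) 0
    ≈⟨ ℚᵘ.*≡* (ℤP.*-assoc (ℤ.+ e) (ℤ.+ ℕ.suc s) (ℤ.+ 1)) ⟩
  ℚᵘ.mkℚᵘ (ℤ.+ e) 0
    ≈⟨ toℚᵘ-toℚ e ⟨
  toℚᵘ (toℚ e) ∎)
  where open ℚᵘP.≃-Reasoning

frac≤⇒≤* : ∀ e {s r} → 1 ≤ s → frac e s ≤ℚ r → toℚ e ≤ℚ r * toℚ s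
frac≤⇒≤* e {ℕ.suc s} _ frac≤r = subst (_≤ℚ _) (frac-*-denominator e s)
  (*-monoʳ-≤-nonNeg (toℚ (ℕ.suc s)) {{nonNegative (toℚ-nonNeg (ℕ.suc s))}} frac≤r)

∈-allSubsets : ∀ {n} (S : Subset n) → S ∈ allSubsets n
∈-allSubsets Vec.[]          = here refl
∈-allSubsets (true Vec.∷ S)  = ∈-++⁺ˡ (∈-map⁺ (true Vec.∷_) (∈-allSubsets S))
∈-allSubsets (false Vec.∷ S) = ∈-++⁺ʳ _ (∈-map⁺ (false Vec.∷_) (∈-allSubsets S))

foldr-⊔-upperBound : ∀ {q} e xs → q ≤ℚ e ⊎ Any (q ≤ℚ_) xs → q ≤ℚ List.foldr _⊔_ e xs
foldr-⊔-upperBound = List.foldr-preservesᵒ λ x y → [ p≤q⇒p≤q⊔r y , p≤q⇒p≤r⊔q x ]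

density≤ρ : ∀ {n} (G : SimpleGraph n) b (S : Subset n) → frac (edgesInᵇ G b S) ∣ S ∣ ≤ℚ ρ G b
density≤ρ G b S = foldr-⊔-upperBound 0ℚ _
  (inj₂ (lose (∈-map⁺ (λ S → frac (edgesInᵇ G b S) ∣ S ∣) (∈-allSubsets S)) ≤-refl))

ρ-nonNeg : ∀ {n} (G : SimpleGraph n) b → 0ℚ ≤ℚ ρ G b
ρ-nonNeg {n} G b = foldr-⊔-upperBound 0ℚ (List.map (λ S → frac (edgesInᵇ G b S) ∣ S ∣) (allSubsets n)) (inj₁ ≤-refl)

edges≤ρ*size : ∀ {n} (G : SimpleGraph n) b (S : Subset n) → 1 ≤ ∣ S ∣ →
  toℚ (edgesInᵇ G b S) ≤ℚ ρ G b * toℚ ∣ S ∣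
edges≤ρ*size G b S 1≤∣S∣ = frac≤⇒≤* (edgesInᵇ G b S) 1≤∣S∣ (density≤ρ G b S)

module _ {n} (G : SimpleGraph n) {b} (O : Orientation G b) where

  inside : (Fin n → Bool) → Fin n → Fin n → ℕ
  inside B u v = bit (B u ∧ B v) ℕ.* out O u v

  inside-diagonal : ∀ B u → inside B u u ≡ 0
  inside-diagonal B u rewrite nonEdge O u u (irrefl G u) = ℕP.*-zeroʳ (bit (B u ∧ B u))

  edgeIn : (Fin n → Bool) → Fin n → Fin n → ℕ
  edgeIn B u v = bit (B u ∧ B v ∧ (Fin.toℕ u ℕ.<ᵇ Fin.toℕ v) ∧ adj G u v)

  below*inside-pair : ∀ B u v → below u v ℕ.* (inside B u v ℕ.+ inside B v u) ≡ b ℕ.* edgeIn B u v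
  below*inside-pair B u v with B u | B v
  ... | false | false = trans (ℕP.*-zeroʳ (below u v)) (sym (ℕP.*-zeroʳ b))
  ... | false | true  = trans (ℕP.*-zeroʳ (below u v)) (sym (ℕP.*-zeroʳ b))
  ... | true  | false = trans (ℕP.*-zeroʳ (below u v)) (sym (ℕP.*-zeroʳ b))
  ... | true  | true with Fin.toℕ u ℕ.<ᵇ Fin.toℕ v | adj G u v in uv
  ...   | false | _     = sym (ℕP.*-zeroʳ b)
  ...   | true  | false
    rewrite nonEdge O u v uv | nonEdge O v u (trans (SimpleGraph.sym G v u) uv) = sym (ℕP.*-zeroʳ b)
  ...   | true  | true
    rewrite ℕP.*-identityˡ (out O u v) | ℕP.*-identityˡ (out O v u) | ℕP.*-identityʳ b =
      trans (ℕP.+-identityʳ _) (split O u v uv)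

  edgesIn-tabulate : ∀ B → edgesIn G (Vec.tabulate B) ≡ ∑ (λ u → ∑ (edgeIn B u))
  edgesIn-tabulate B = trans (Σv≡∑ n _) (ℕΣ.sum-cong-≗ λ u → trans (Σv≡∑ n _) (ℕΣ.sum-cong-≗ λ v →
    cong₂ (λ x y → bit (x ∧ y ∧ (Fin.toℕ u ℕ.<ᵇ Fin.toℕ v) ∧ adj G u v))
          (VecP.lookup∘tabulate B u) (VecP.lookup∘tabulate B v)))

  edgesInᵇ-tabulate : ∀ B → edgesInᵇ G b (Vec.tabulate B) ≡ ∑ (λ u → ∑ (inside B u))
  edgesInᵇ-tabulate B = begin
    b ℕ.* edgesIn G (Vec.tabulate B)
      ≡⟨ cong (b ℕ.*_) (edgesIn-tabulate B) ⟩
    b ℕ.* ∑ (λ u → ∑ (edgeIn B u))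
      ≡⟨ ∑∑-*-distribˡ b (edgeIn B) ⟩
    ∑ (λ u → ∑ (λ v → b ℕ.* edgeIn B u v))
      ≡⟨ ℕΣ.sum-cong-≗ (λ u → ℕΣ.sum-cong-≗ (below*inside-pair B u)) ⟨
    ∑ (λ u → ∑ (λ v → below u v ℕ.* (inside B u v ℕ.+ inside B v u)))
      ≡⟨ ∑∑-symmetrize (inside B) (inside-diagonal B) ⟨
    ∑ (λ u → ∑ (inside B u)) ∎
    where open ≡-Reasoning

  ∑-outdegree≤edgesInᵇ : ∀ (A B : Fin n → Bool) → (∀ v → T (A v) → T (B v)) →
    (∀ u v → T (A u) → 1 ≤ out O u v → T (B v)) →
    ∑ (λ u → bit (A u) ℕ.* d⁺ O u) ≤ edgesInᵇ G b (Vec.tabulate B)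
  ∑-outdegree≤edgesInᵇ A B A⊆B A-arcs⊆B = begin
    ∑ (λ u → bit (A u) ℕ.* d⁺ O u)
      ≡⟨ ℕΣ.sum-cong-≗ (λ u → trans (cong (bit (A u) ℕ.*_) (Σv≡∑ n (out O u)))
                                     (ℕΣ.*-distribˡ-sum (bit (A u)) (out O u))) ⟩
    ∑ (λ u → ∑ (λ v → bit (A u) ℕ.* out O u v))
      ≤⟨ ∑-mono-≤ (λ u → ∑-mono-≤ (λ v → bit-*-mono (A u) (B u ∧ B v) (out O u v) λ Au arc →
           Equivalence.from T-∧ (A⊆B u Au , A-arcs⊆B u v Au arc))) ⟩
    ∑ (λ u → ∑ (inside B u))
      ≡⟨ edgesInᵇ-tabulate B ⟨
    edgesInᵇ G b (Vec.tabulate B) ∎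
    where open ℕP.≤-Reasoning

module Balls {n} {G : SimpleGraph n} {b} (O : Orientation G b) (centre : Fin n) where

  ball : ℕ → Fin n → Bool
  arc-into? : ∀ i v → Dec (∃[ u ] (T (ball i u) × 1 ≤ out O u v))

  ball ℕ.zero    v = isYes (v Fin.≟ centre)
  ball (ℕ.suc i) v = ball i v ∨ isYes (arc-into? i v)

  arc-into? i v = any? λ u → T? (ball i u) ×-dec 1 ℕ.≤? out O u v

  centre∈ball : ∀ i → T (ball i centre)
  centre∈ball ℕ.zero    = fromWitness refl
  centre∈ball (ℕ.suc i) = Equivalence.from T-∨ (inj₁ (centre∈ball i))

  ball-zero⁻ : ∀ {v} → T (ball 0 v) → v ≡ centre
  ball-zero⁻ = toWitness

  ball-⊆ : ∀ i {v} → T (ball i v) → T (ball (ℕ.suc i) v)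
  ball-⊆ i v∈ = Equivalence.from T-∨ (inj₁ v∈)

  ball-arc : ∀ i {u v} → T (ball i u) → 1 ≤ out O u v → T (ball (ℕ.suc i) v)
  ball-arc i u∈ arc = Equivalence.from T-∨ (inj₂ (fromWitness {a? = arc-into? i _} (_ , u∈ , arc)))

  ball-suc⁻ : ∀ i {v} → T (ball (ℕ.suc i) v) → T (ball i v) ⊎ ∃[ u ] (T (ball i u) × 1 ≤ out O u v)
  ball-suc⁻ i v∈ = Sum.map₂ toWitness (Equivalence.to T-∨ v∈)

  1≤size-ball : ∀ i → 1 ≤ size (ball i)
  1≤size-ball i = ℕP.≤-trans (bit-T (centre∈ball i)) (f≤∑ (bit ∘ ball i) centre)

  size-ball≤n : ∀ i → size (ball i) ≤ n
  size-ball≤n i = subst (size (ball i) ≤_) (ℕP.*-identityʳ n) (∑-≤-* (λ v → bit≤1 (ball i v)))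

  module _ (w : Fin n → ℚ) {α β : ℚ} (β*α≡1 : β * α ≡ 1ℚ) (0≤β : 0ℚ ≤ℚ β) (β≤1 : β ≤ℚ 1ℚ)
           (0≤w : ∀ v → 0ℚ ≤ℚ w v) (w-arc : ∀ u v → 1 ≤ out O u v → w u ≤ℚ α * w v) where

    ball-lowerBound : ∀ i {v} → T (ball i v) → pow β i * w centre ≤ℚ w v
    ball-lowerBound ℕ.zero v∈ rewrite ball-zero⁻ v∈ = ≤-reflexive (*-identityˡ (w centre))
    ball-lowerBound (ℕ.suc i) {v} v∈ = [ from-ball , from-arc ] (ball-suc⁻ i v∈)
      where
      open ≤-Reasoning

      step : ∀ {x} → T (ball i x) → pow β (ℕ.suc i) * w centre ≤ℚ β * w x
      step x∈ = ≤-trans (≤-reflexive (*-assoc β (pow β i) (w centre)))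
                        (*-monoˡ-≤-nonNeg β {{nonNegative 0≤β}} (ball-lowerBound i x∈))

      from-ball : T (ball i v) → pow β (ℕ.suc i) * w centre ≤ℚ w v
      from-ball v∈ᵢ = begin
        pow β (ℕ.suc i) * w centre ≤⟨ step v∈ᵢ ⟩
        β * w v                    ≤⟨ *-monoʳ-≤-nonNeg (w v) {{nonNegative (0≤w v)}} β≤1 ⟩
        1ℚ * w v                   ≡⟨ *-identityˡ (w v) ⟩
        w v                        ∎

      from-arc : ∃[ u ] (T (ball i u) × 1 ≤ out O u v) → pow β (ℕ.suc i) * w centre ≤ℚ w v
      from-arc (u , u∈ , arc) = begin
        pow β (ℕ.suc i) * w centre ≤⟨ step u∈ ⟩
        β * w u                    ≤⟨ *-monoˡ-≤-nonNeg β {{nonNegative 0≤β}} (w-arc u v arc) ⟩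
        β * (α * w v)              ≡⟨ trans (sym (*-assoc β α (w v))) (cong (_* w v) β*α≡1) ⟩
        1ℚ * w v                   ≡⟨ *-identityˡ (w v) ⟩
        w v                        ∎

  stalled-ball-bound : ∀ {x K γ} k → (∀ v → T (ball k v) → x ≤ℚ toℚ (d⁺ O v) + K) →
    toℚ (size (ball (ℕ.suc k))) <ℚ (1ℚ + γ) * toℚ (size (ball k)) →
    x ≤ℚ (1ℚ + γ) * ρ G b + K
  stalled-ball-bound {x} {K} {γ} k x≤d+K stalled = *-cancelˡ-≤-pos t {{positive (toℚ-pos (1≤size-ball k))}} (begin
    t * x                                  ≤⟨ size*≤∑ (ball k) (d⁺ O) x≤d+K ⟩
    toℚ (∑ (λ v → bit (ball k v) ℕ.* d⁺ O v)) + t * K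
      ≤⟨ +-monoˡ-≤ (t * K) (toℚ-mono
           (∑-outdegree≤edgesInᵇ G O (ball k) (ball (ℕ.suc k)) (λ _ → ball-⊆ k) (λ _ _ → ball-arc k))) ⟩
    toℚ (edgesInᵇ G b S) + t * K           ≤⟨ +-monoˡ-≤ (t * K) (edges≤ρ*size G b S 1≤∣S∣) ⟩
    ρ G b * toℚ ∣ S ∣ + t * K              ≡⟨ cong (λ s → ρ G b * toℚ s + t * K) (∣tabulate∣≡size (ball (ℕ.suc k))) ⟩
    ρ G b * toℚ (size (ball (ℕ.suc k))) + t * K
      ≤⟨ +-monoˡ-≤ (t * K) (*-monoˡ-≤-nonNeg (ρ G b) {{nonNegative (ρ-nonNeg G b)}} (<⇒≤ stalled)) ⟩
    ρ G b * ((1ℚ + γ) * t) + t * K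
      ≡⟨ solve 4 (λ r g t k → r :* ((con 1ℚ :+ g) :* t) :+ t :* k := t :* ((con 1ℚ :+ g) :* r :+ k)) refl (ρ G b) γ t K ⟩
    t * ((1ℚ + γ) * ρ G b + K)             ∎)
    where
    open ≤-Reasoning
    open +-*-Solver
    t : ℚ
    t = toℚ (size (ball k))
    S : Subset n
    S = Vec.tabulate (ball (ℕ.suc k))
    1≤∣S∣ : 1 ≤ ∣ S ∣
    1≤∣S∣ = subst (1 ≤_) (sym (∣tabulate∣≡size (ball (ℕ.suc k)))) (1≤size-ball (ℕ.suc k))

  out-ball-bound : ∀ {α K γ} → 1ℚ ≤ℚ α → 0ℚ ≤ℚ K → 0ℚ <ℚ γ →
    (∀ u v → 1 ≤ out O u v → toℚ (d⁺ O u) + K ≤ℚ α * (toℚ (d⁺ O v) + K)) →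
    ∃[ k ] (pow (1ℚ + γ) k ≤ℚ toℚ n × pow (inv α) k * (toℚ (d⁺ O centre) + K) ≤ℚ (1ℚ + γ) * ρ G b + K)
  out-ball-bound {α} {K} {γ} 1≤α 0≤K 0<γ arc-bound
    with k , pow≤size , stalled ← growth-stalls 0<γ (size ∘ ball) 1≤size-ball size-ball≤n
    = k , ≤-trans pow≤size (toℚ-mono (size-ball≤n k))
        , stalled-ball-bound {γ = γ} k
            (λ v → ball-lowerBound w inv-α*α≡1 (<⇒≤ (inv-pos 0<α)) (inv≤1 1≤α) 0≤w arc-bound k) stalled
    where
    w : Fin n → ℚ
    w v = toℚ (d⁺ O v) + K
    0<α : 0ℚ <ℚ α
    0<α = <-≤-trans (positive⁻¹ 1ℚ) 1≤α
    inv-α*α≡1 : inv α * α ≡ 1ℚ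
    inv-α*α≡1 = trans (*-comm (inv α) α) (*-inv 0<α)
    0≤w : ∀ v → 0ℚ ≤ℚ w v
    0≤w v = +-mono-≤ (toℚ-nonNeg (d⁺ O v)) 0≤K

Δ-attained : ∀ {m} {G : SimpleGraph (ℕ.suc m)} {b} (O : Orientation G b) → ∃[ u ] Δ O ≤ d⁺ O u
Δ-attained {m} O with foldr-selective ℕP.⊔-sel 0 (List.map (d⁺ O) (List.allFin (ℕ.suc m)))
... | inj₁ Δ≡0 = Fin.zero , ℕP.≤-trans (ℕP.≤-reflexive Δ≡0) ℕ.z≤n
... | inj₂ Δ∈  with u , _ , Δ≡d⁺u ← ∈-map⁻ (d⁺ O) Δ∈ = u , ℕP.≤-reflexive Δ≡d⁺u

slack-identity : ∀ {η q} c → 0ℚ <ℚ η → 0ℚ <ℚ q →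
  (1ℚ + η * inv q) * (c * (inv η * q)) ≡ c * (inv η * q) + c
slack-identity {η} {q} c 0<η 0<q = begin
  (1ℚ + η * inv q) * (c * (inv η * q))      ≡⟨ solve 5 (λ η iq c iη q →
      (con 1ℚ :+ η :* iq) :* (c :* (iη :* q)) := c :* (iη :* q) :+ c :* ((η :* iη) :* (q :* iq))) refl η (inv q) c (inv η) q ⟩
  c * (inv η * q) + c * ((η * inv η) * (q * inv q))
    ≡⟨ cong₂ (λ x y → c * (inv η * q) + c * (x * y)) (*-inv 0<η) (*-inv 0<q) ⟩
  c * (inv η * q) + c * (1ℚ * 1ℚ)            ≡⟨ cong (c * (inv η * q) +_) (*-identityʳ c) ⟩
  c * (inv η * q) + c                        ∎
  where open ≡-Reasoning
        open +-*-Solver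

theorem2 : (n : ℕ) → 1 ≤ n → (G : SimpleGraph n) → (b : ℕ) → 1 ≤ b →
    (η c : ℚ) → 0ℚ <ℚ η → 0ℚ ≤ℚ c →
    (O : Orientation G b) →
    (∀ u v → 1 ≤ out O u v →
      toℚ (d⁺ O u) ≤ℚ (1ℚ + η * inv (toℚ b)) * toℚ (d⁺ O v) + c) →
    (γ : ℚ) → 0ℚ <ℚ γ →
    ∃[ kmax ] (pow (1ℚ + γ) kmax ≤ℚ toℚ n
      × pow (inv (1ℚ + η * inv (toℚ b))) kmax * toℚ (Δ O)
          ≤ℚ (1ℚ + γ) * ρ G b + c * (inv η * toℚ b + 1ℚ))
theorem2 (ℕ.suc m) _ G b 1≤b η c 0<η 0≤c O arc-condition γ 0<γ =
  Product.map₂ (λ {k} → Product.map₂ (finish {k})) (Balls.out-ball-bound O centre 1≤α 0≤K 0<γ arc-bound)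
  where
  α β K : ℚ
  α = 1ℚ + η * inv (toℚ b)
  β = inv α
  K = c * (inv η * toℚ b)

  0<b : 0ℚ <ℚ toℚ b
  0<b = toℚ-pos 1≤b
  1≤α : 1ℚ ≤ℚ α
  1≤α = p≤p+q (<⇒≤ (*-pos 0<η (inv-pos 0<b)))
  0≤β : 0ℚ ≤ℚ β
  0≤β = <⇒≤ (inv-pos (<-≤-trans (positive⁻¹ 1ℚ) 1≤α))
  0≤K : 0ℚ ≤ℚ K
  0≤K = *-nonNeg 0≤c (*-nonNeg (<⇒≤ (inv-pos 0<η)) (<⇒≤ 0<b))

  arc-bound : ∀ u v → 1 ≤ out O u v → toℚ (d⁺ O u) + K ≤ℚ α * (toℚ (d⁺ O v) + K)
  arc-bound u v arc = absorb-slack {α} (slack-identity c 0<η 0<b) (arc-condition u v arc)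

  centre : Fin (ℕ.suc m)
  centre = proj₁ (Δ-attained O)

  finish : ∀ {k} → pow β k * (toℚ (d⁺ O centre) + K) ≤ℚ (1ℚ + γ) * ρ G b + K →
    pow β k * toℚ (Δ O) ≤ℚ (1ℚ + γ) * ρ G b + c * (inv η * toℚ b + 1ℚ)
  finish {k} bound = begin
    pow β k * toℚ (Δ O)
      ≤⟨ *-monoˡ-≤-nonNeg (pow β k) {{nonNegative (pow-nonNeg k 0≤β)}}
           (≤-trans (toℚ-mono (proj₂ (Δ-attained O))) (p≤p+q 0≤K)) ⟩
    pow β k * (toℚ (d⁺ O centre) + K)           ≤⟨ bound ⟩
    (1ℚ + γ) * ρ G b + K
      ≤⟨ +-monoʳ-≤ ((1ℚ + γ) * ρ G b) (*-monoˡ-≤-nonNeg c {{nonNegative 0≤c}} (p≤p+q (nonNegative⁻¹ 1ℚ))) ⟩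
    (1ℚ + γ) * ρ G b + c * (inv η * toℚ b + 1ℚ) ∎
    where open ≤-Reasoning
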